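{- Let $C$ be a $\mathbb{Z}_2$-linear code. Then $C$ is a $\mathbb{Z}_2\mathbb{Z}_2[u]$-linear code with parameters $(\alpha,\beta)$, where $\beta>0$, if and only if there exists an involution (element of order $2$) $\sigma\in\mathrm{Aut}(C)$ fixing exactly $\alpha$ coordinates.
   Context: Let $\mathbb{Z}_2[u]=\{0,1,u,1+u\}$ be the ring $\mathbb{Z}_2+u\mathbb{Z}_2$ with $u^2=0$. Define $\pi:\mathbb{Z}_2[u]\to\mathbb{Z}_2$ by $\pi(0)=\pi(u)=0$, $\pi(1)=\pi(1+u)=1$. The set $\mathbb{Z}_2^\alpha\times\mathbb{Z}_2[u]^\beta$ is a $\mathbb{Z}_2[u]$-module under componentwise addition and the scalar multiplication $\lambda(x_1,\dots,x_\alpha\mid x'_1,\dots,x'_\beta)=(\pi(\lambda)x_1,\dots,\pi(\lambda)x_\alpha\mid \lambda x'_1,\dots,\lambda x'_\beta)$. A $\mathbb{Z}_2\mathbb{Z}_2[u]$-additive code with parameters $(\alpha,\beta)$ is a $\mathbb{Z}_2[u]$-submodule of $\mathbb{Z}_2^\alpha\times\mathbb{Z}_2[u]^\beta$. Let $\psi:\mathbb{Z}_2[u]\to\mathbb{Z}_2^2$ be given by $\psi(0)=(0,0)$, $\psi(1)=(0,1)$, $\psi(u)=(1,1)$, $\psi(1+u)=(1,0)$, extended coordinatewise, and let $\Psi(x\mid x')=(x\mid\psi(x'))\in\mathbb{Z}_2^{\alpha+2\beta}$. A binary code $C$ of length $\alpha+2\beta$ is called $\mathbb{Z}_2\mathbb{Z}_2[u]$-linear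 with parameters $(\alpha,\beta)$ if, after a suitable permutation of its coordinates, $C=\Psi(\mathcal{C})$ for some $\mathbb{Z}_2\mathbb{Z}_2[u]$-additive code $\mathcal{C}$ with parameters $(\alpha,\beta)$. For a binary code $C$, $\mathrm{Aut}(C)$ is the group of coordinate permutations leaving $C$ invariant. -}

module Defs where

open import Data.Bool using (Bool; true; false; _xor_; _∧_)
open import Data.Nat using (ℕ; _+_; _*_)
open import Data.Nat.Properties using (*-comm)
open import Data.Fin using (Fin)
open import Data.Fin.Properties using (_≟_)
open import Data.Fin.Permutation using (Permutation′; _⟨$⟩ʳ_)
open import Data.Vec using (Vec; []; _∷_; _++_; concat; map; zipWith; replicate; tabulate; lookup; cast)
open import Data.List using (length; filter; allFin)
open import Data.Product using (Σ; _×_; _,_; ∃)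
open import Relation.Binary.PropositionalEquality using (_≡_)
open import Relation.Nullary using (¬_)
open import Function.Bundles using (_⇔_)

-- The ring Z2[u] = {0, 1, u, 1+u} with u^2 = 0.
data Z2u : Set where
  𝟘 𝟙 𝕦 𝟙𝕦 : Z2u

toPair : Z2u → Bool × Bool
toPair 𝟘 = false , false
toPair 𝟙 = true , false
toPair 𝕦 = false , true
toPair 𝟙𝕦 = true , true

fromPair : Bool × Bool → Z2u
fromPair (false , false) = 𝟘
fromPair (true , false) = 𝟙
fromPair (false , true) = 𝕦
fromPair (true , true) = 𝟙𝕦

_+u_ : Z2u → Z2u → Z2u
x +u y with toPair x | toPair y
... | a , b | c , d = fromPair (a xor c , b xor d)

-- (a + b u)(c + d u) = ac + (ad + bc) u
_*u_ : Z2u → Z2u → Z2u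
x *u y with toPair x | toPair y
... | a , b | c , d = fromPair (a ∧ c , (a ∧ d) xor (b ∧ c))

πu : Z2u → Bool
πu 𝟘 = false
πu 𝟙 = true
πu 𝕦 = false
πu 𝟙𝕦 = true

ψ : Z2u → Vec Bool 2
ψ 𝟘 = false ∷ false ∷ []
ψ 𝟙 = false ∷ true ∷ []
ψ 𝕦 = true ∷ true ∷ []
ψ 𝟙𝕦 = true ∷ false ∷ []

Word : ℕ → Set
Word n = Vec Bool n

IsBinaryLinear : ∀ {n} → (Word n → Set) → Set
IsBinaryLinear {n} C =
  C (replicate n false) × (∀ x y → C x → C y → C (zipWith _xor_ x y))

Elem : ℕ → ℕ → Set
Elem α β = Vec Bool α × Vec Z2u β

zeroE : ∀ {α β} → Elem α β
zeroE {α} {β} = replicate α false , replicate β 𝟘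

addE : ∀ {α β} → Elem α β → Elem α β → Elem α β
addE (x , x') (y , y') = zipWith _xor_ x y , zipWith _+u_ x' y'

smulE : ∀ {α β} → Z2u → Elem α β → Elem α β
smulE λ' (x , x') = map (λ a → πu λ' ∧ a) x , map (λ a → λ' *u a) x'

IsAdditive : ∀ {α β} → (Elem α β → Set) → Set
IsAdditive {α} {β} 𝒞 =
  𝒞 zeroE ×
  (∀ x y → 𝒞 x → 𝒞 y → 𝒞 (addE x y)) ×
  (∀ λ' x → 𝒞 x → 𝒞 (smulE λ' x))

Ψ : ∀ {α β} → Elem α β → Word (α + 2 * β)
Ψ {α} {β} (x , x') = x ++ cast (*-comm β 2) (concat (map ψ x'))

permute : ∀ {n} → Permutation′ n → Word n → Word n
permute σ w = tabulate (λ i → lookup w (σ ⟨$⟩ʳ i))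

IsZ2Z2uLinear : (α β : ℕ) → (Word (α + 2 * β) → Set) → Set₁
IsZ2Z2uLinear α β C =
  Σ (Elem α β → Set) λ 𝒞 → IsAdditive 𝒞 ×
  Σ (Permutation′ (α + 2 * β)) λ π →
    ∀ w → C (permute π w) ⇔ (∃ λ c → 𝒞 c × Ψ c ≡ w)

InAut : ∀ {n} → (Word n → Set) → Permutation′ n → Set
InAut C σ = ∀ w → C w ⇔ C (permute σ w)

HasOrder2 : ∀ {n} → Permutation′ n → Set
HasOrder2 σ = (∀ i → σ ⟨$⟩ʳ (σ ⟨$⟩ʳ i) ≡ i) × ¬ (∀ i → σ ⟨$⟩ʳ i ≡ i)

numFixed : ∀ {n} → Permutation′ n → ℕ
numFixed {n} σ = length (filter (λ i → σ ⟨$⟩ʳ i ≟ i) (allFin n))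

module Submission where

-- The Gray map turns multiplication by the unit 1 + u into the involution τ swapping the two
-- bits of every Gray pair, and since u = 1 + (1 + u), an additive subgroup of Z₂^α × Z₂[u]^β is
-- a Z₂[u]-submodule as soon as it is closed under multiplication by 1 + u. Hence a binary linear
-- code is Z₂Z₂[u]-linear via a coordinate permutation π exactly when C ∘ π is τ-invariant, that is,
-- when C is invariant under the conjugate of τ by π: an involution with α fixed points, nontrivial
-- because β > 0. Conversely, an involution with α fixed points splits the α + 2β coordinates into
-- its fixed points and β two-cycles {i, σ i} (listed from i < σ i), so it is conjugate to τ.

open import Defs
open import Data.Bool using (Bool; true; false; _xor_)
import Data.Bool.Properties as Boolₚ
open import Data.Empty using (⊥-elim)
open import Data.Fin as Fin using (Fin; zero; suc; opposite; _↑ʳ_; combine)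
open import Data.Fin.Patterns using (0F; 1F)
import Data.Fin.Properties as Finₚ
open import Data.Fin.Permutation using (Permutation′; _⟨$⟩ʳ_; inverseˡ; cast-id; ↔⇒≡)
open import Data.List using (length; filter; allFin)
import Data.List as List
open import Data.Nat using (ℕ; _+_; _*_; _<_)
import Data.Nat.Properties as ℕₚ
open import Data.Product as Product using (Σ; _×_; _,_; proj₁; proj₂; ∃)
open import Data.Product.Function.Dependent.Propositional using (Σ-↔)
open import Data.Product.Function.NonDependent.Propositional using (_×-↔_)
open import Data.Sum as Sum using (_⊎_; inj₁; inj₂)
open import Data.Sum.Function.Propositional using (_⊎-↔_)
open import Data.Vec as Vec using (Vec; []; _∷_; _++_; concat; lookup; tabulate; replicate; zipWith; map)
import Data.Vec.Properties as Vecₚ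
open import Function using (_∘_; id)
open import Function.Bundles using (_↔_; _⇔_; mk⇔; mk↔ₛ′; Inverse; Injection; Equivalence)
open import Function.Properties.Inverse using (↔-refl; ↔-sym; ↔-trans; ↔⇒↣)
open import Relation.Binary.PropositionalEquality
open import Relation.Nullary using (¬_; yes; no; Irrelevant)
open import Relation.Unary using (Pred; Decidable)
open import Relation.Binary.Definitions using (tri<; tri≈; tri>)
open import Axiom.UniquenessOfIdentityProofs.WithK using (uip)

open Inverse using (to; from; strictlyInverseˡ; strictlyInverseʳ)

private variable
  A B X : Set
  m n α β : ℕ

Σ-Fin-suc-↔ : {P : Fin (ℕ.suc n) → Set} → Σ (Fin (ℕ.suc n)) P ↔ (P zero ⊎ Σ (Fin n) (P ∘ suc))
Σ-Fin-suc-↔ = mk↔ₛ′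
  (λ { (zero , p) → inj₁ p ; (suc i , p) → inj₂ (i , p) })
  (λ { (inj₁ p) → zero , p ; (inj₂ (i , p)) → suc i , p })
  (λ { (inj₁ p) → refl ; (inj₂ (i , p)) → refl })
  (λ { (zero , p) → refl ; (suc i , p) → refl })

Fin-suc-↔ : (x : X) → (∀ y → x ≡ y) → Fin (ℕ.suc m) ↔ (X ⊎ Fin m)
Fin-suc-↔ x unique = mk↔ₛ′
  (λ { zero → inj₁ x ; (suc i) → inj₂ i })
  (λ { (inj₁ _) → zero ; (inj₂ i) → suc i })
  (λ { (inj₁ y) → cong inj₁ (unique y) ; (inj₂ i) → refl })
  (λ { zero → refl ; (suc i) → refl })

⊎-absorbˡ-↔ : ¬ X → (X ⊎ B) ↔ B
⊎-absorbˡ-↔ ¬x = mk↔ₛ′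
  (λ { (inj₁ x) → ⊥-elim (¬x x) ; (inj₂ b) → b })
  inj₂
  (λ _ → refl)
  (λ { (inj₁ x) → ⊥-elim (¬x x) ; (inj₂ b) → refl })

filter-tabulate-↔ : {P : Pred A _} (P? : Decidable P) → (∀ {a} → Irrelevant (P a)) →
  (f : Fin n → A) → Fin (length (filter P? (List.tabulate f))) ↔ Σ (Fin n) (P ∘ f)
filter-tabulate-↔ {n = ℕ.zero} P? irr f = mk↔ₛ′ (λ ()) (λ ()) (λ ()) (λ ())
filter-tabulate-↔ {n = ℕ.suc n} P? irr f with P? (f zero)
... | yes p = ↔-trans (Fin-suc-↔ p (irr p))
               (↔-trans (↔-refl ⊎-↔ filter-tabulate-↔ P? irr (f ∘ suc)) (↔-sym Σ-Fin-suc-↔))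
... | no ¬p = ↔-trans (filter-tabulate-↔ P? irr (f ∘ suc))
               (↔-trans (↔-sym (⊎-absorbˡ-↔ ¬p)) (↔-sym Σ-Fin-suc-↔))

record Conjugates (e : A ↔ B) (f : A → A) (g : B → B) : Set where
  constructor conjugates
  field commute : ∀ a → to e (f a) ≡ g (to e a)

open Conjugates

module _ {e : A ↔ B} {f : A → A} {g : B → B} (e-conj : Conjugates e f g) where

  private
    to-injective : ∀ {a a′} → to e a ≡ to e a′ → a ≡ a′
    to-injective = Injection.injective (↔⇒↣ e)

  conjugates-sym : Conjugates (↔-sym e) g f
  conjugates-sym = conjugates λ b → to-injective (begin
    to e (from e (g b))     ≡⟨ strictlyInverseˡ e (g b) ⟩
    g b                     ≡⟨ cong g (strictlyInverseˡ e b) ⟨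
    g (to e (from e b))     ≡⟨ commute e-conj (from e b) ⟨
    to e (f (from e b)) ∎)
    where open ≡-Reasoning

  conjugates-involutive : (∀ b → g (g b) ≡ b) → ∀ a → f (f a) ≡ a
  conjugates-involutive g-inv a = to-injective (begin
    to e (f (f a))   ≡⟨ commute e-conj (f a) ⟩
    g (to e (f a))   ≡⟨ cong g (commute e-conj a) ⟩
    g (g (to e a))   ≡⟨ g-inv (to e a) ⟩
    to e a ∎)
    where open ≡-Reasoning

  conjugates-fixed⇔ : ∀ a → f a ≡ a ⇔ g (to e a) ≡ to e a
  conjugates-fixed⇔ a = mk⇔
    (λ fa≡a → trans (sym (commute e-conj a)) (cong (to e) fa≡a))
    (λ ga≡a → to-injective (trans (commute e-conj a) ga≡a))

  conjugates-id : (∀ a → f a ≡ a) → ∀ b → g b ≡ b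
  conjugates-id f≗id b = subst (λ b′ → g b′ ≡ b′) (strictlyInverseˡ e b)
    (Equivalence.to (conjugates-fixed⇔ (from e b)) (f≗id (from e b)))

conjugates-trans : ∀ {C : Set} {e : A ↔ B} {e′ : B ↔ C} {f g h} →
  Conjugates e f g → Conjugates e′ g h → Conjugates (↔-trans e e′) f h
conjugates-trans {e = e} {e′} e-conj e′-conj = conjugates λ a →
  trans (cong (to e′) (commute e-conj a)) (commute e′-conj (to e a))

Fix : (A → A) → Set
Fix {A} f = Σ A λ a → f a ≡ a

Fix-↔ : {e : A ↔ B} {f : A → A} {g : B → B} → Conjugates e f g → Fix f ↔ Fix g
Fix-↔ {e = e} e-conj = Σ-↔ e (mk↔ₛ′
  (Equivalence.to (conjugates-fixed⇔ e-conj _)) (Equivalence.from (conjugates-fixed⇔ e-conj _))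
  (λ _ → uip _ _) (λ _ → uip _ _))

conjugate : A ↔ B → B ↔ B → A ↔ A
conjugate e g = ↔-trans e (↔-trans g (↔-sym e))

conjugate-conjugates : (e : A ↔ B) (g : B ↔ B) → Conjugates e (to (conjugate e g)) (to g)
conjugate-conjugates e g = conjugates λ a → strictlyInverseˡ e (to g (to e a))

swapPairs : X ⊎ (B × Fin 2) → X ⊎ (B × Fin 2)
swapPairs = Sum.map₂ (Product.map₂ opposite)

swapPairs-involutive : (y : X ⊎ (B × Fin 2)) → swapPairs (swapPairs y) ≡ y
swapPairs-involutive (inj₁ x) = refl
swapPairs-involutive (inj₂ (b , i)) = cong (λ j → inj₂ (b , j)) (Finₚ.opposite-involutive i)

swapPairs-↔ : (X ⊎ (B × Fin 2)) ↔ (X ⊎ (B × Fin 2))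
swapPairs-↔ = mk↔ₛ′ swapPairs swapPairs swapPairs-involutive swapPairs-involutive

relabel-conjugates : ∀ {X′ B′ : Set} (f : X ↔ X′) (g : B ↔ B′) →
  Conjugates (f ⊎-↔ (g ×-↔ ↔-refl)) swapPairs swapPairs
relabel-conjugates f g = conjugates λ { (inj₁ x) → refl ; (inj₂ (b , i)) → refl }

Fix-swapPairs-↔ : Fix (swapPairs {X} {B}) ↔ X
Fix-swapPairs-↔ = mk↔ₛ′
  (λ { (inj₁ x , _) → x ; (inj₂ (_ , 0F) , ()) ; (inj₂ (_ , 1F) , ()) })
  (λ x → inj₁ x , refl)
  (λ _ → refl)
  (λ { (inj₁ x , refl) → refl ; (inj₂ (_ , 0F) , ()) ; (inj₂ (_ , 1F) , ()) })

module Involution {s : Fin n → Fin n} (s-involutive : ∀ i → s (s i) ≡ i) where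

  Pairs : Set
  Pairs = Σ (Fin n) λ i → i Fin.< s i

  Pairs-≡ : ∀ {i j} {i<si : i Fin.< s i} {j<sj : j Fin.< s j} → i ≡ j → (i , i<si) ≡ (j , j<sj)
  Pairs-≡ refl = cong (_ ,_) (Finₚ.<-irrelevant _ _)

  classify : Fin n → Fix s ⊎ (Pairs × Fin 2)
  classify i with Finₚ.<-cmp i (s i)
  ... | tri< i<si _ _ = inj₂ ((i , i<si) , 0F)
  ... | tri≈ _ i≡si _ = inj₁ (i , sym i≡si)
  ... | tri> _ _ si<i = inj₂ ((s i , subst (s i Fin.<_) (sym (s-involutive i)) si<i) , 1F)

  unclassify : Fix s ⊎ (Pairs × Fin 2) → Fin n
  unclassify (inj₁ (i , _)) = i
  unclassify (inj₂ ((i , _) , 0F)) = i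
  unclassify (inj₂ ((i , _) , 1F)) = s i

  unclassify-classify : ∀ i → unclassify (classify i) ≡ i
  unclassify-classify i with Finₚ.<-cmp i (s i)
  ... | tri< _ _ _ = refl
  ... | tri≈ _ _ _ = refl
  ... | tri> _ _ _ = s-involutive i

  classify-unclassify : ∀ y → classify (unclassify y) ≡ y
  classify-unclassify (inj₁ (i , si≡i)) with Finₚ.<-cmp i (s i)
  ... | tri< _ i≢si _ = ⊥-elim (i≢si (sym si≡i))
  ... | tri≈ _ _ _ = cong (λ p → inj₁ (i , p)) (uip _ _)
  ... | tri> _ i≢si _ = ⊥-elim (i≢si (sym si≡i))
  classify-unclassify (inj₂ ((i , i<si) , 0F)) with Finₚ.<-cmp i (s i)
  ... | tri< _ _ _ = cong (λ p → inj₂ (p , 0F)) (Pairs-≡ refl)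
  ... | tri≈ i≮si _ _ = ⊥-elim (i≮si i<si)
  ... | tri> i≮si _ _ = ⊥-elim (i≮si i<si)
  classify-unclassify (inj₂ ((i , i<si) , 1F)) with Finₚ.<-cmp (s i) (s (s i))
  ... | tri< _ _ ssi≮si = ⊥-elim (ssi≮si (subst (Fin._< s i) (sym (s-involutive i)) i<si))
  ... | tri≈ _ _ ssi≮si = ⊥-elim (ssi≮si (subst (Fin._< s i) (sym (s-involutive i)) i<si))
  ... | tri> _ _ _ = cong (λ p → inj₂ (p , 1F)) (Pairs-≡ (s-involutive i))

  unclassify-↔ : (Fix s ⊎ (Pairs × Fin 2)) ↔ Fin n
  unclassify-↔ = mk↔ₛ′ unclassify classify unclassify-classify classify-unclassify

  unclassify-conjugates : Conjugates unclassify-↔ swapPairs s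
  unclassify-conjugates = conjugates λ
    { (inj₁ (i , si≡i)) → sym si≡i
    ; (inj₂ ((i , _) , 0F)) → refl
    ; (inj₂ ((i , _) , 1F)) → sym (s-involutive i) }

  involution-↔ : Fin n ↔ (Fix s ⊎ (Pairs × Fin 2))
  involution-↔ = ↔-sym unclassify-↔

  involution-↔-conjugates : Conjugates involution-↔ s swapPairs
  involution-↔-conjugates = conjugates-sym unclassify-conjugates

  Pairs-↔ : Fix s ↔ Fin α → n ≡ α + 2 * β → Pairs ↔ Fin β
  Pairs-↔ {α} {β} fix↔ n≡α+2β = subst (λ k → Pairs ↔ Fin k) r≡β pairs↔
    where
    r = length (filter (λ i → i Finₚ.<? s i) (allFin n))
    pairs↔ : Pairs ↔ Fin r
    pairs↔ = ↔-sym (filter-tabulate-↔ (λ i → i Finₚ.<? s i) Finₚ.<-irrelevant id)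
    n≡α+r*2 : n ≡ α + r * 2
    n≡α+r*2 = ↔⇒≡ (↔-trans involution-↔ (↔-trans (fix↔ ⊎-↔ (pairs↔ ×-↔ ↔-refl))
      (↔-sym (↔-trans Finₚ.+↔⊎ (↔-refl ⊎-↔ Finₚ.*↔×)))))
    r≡β : r ≡ β
    r≡β = ℕₚ.*-cancelʳ-≡ r β 2 (trans (ℕₚ.+-cancelˡ-≡ α _ _ (trans (sym n≡α+r*2) n≡α+2β)) (ℕₚ.*-comm 2 β))

tabulate-≡ : ∀ {f : Fin n → A} {v} → (∀ i → f i ≡ lookup v i) → tabulate f ≡ v
tabulate-≡ {v = v} eq = trans (Vecₚ.tabulate-cong eq) (Vecₚ.tabulate∘lookup v)

lookup-ext : ∀ {v w : Vec A n} → (∀ i → lookup v i ≡ lookup w i) → v ≡ w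
lookup-ext {v = v} eq = trans (sym (Vecₚ.tabulate∘lookup v)) (tabulate-≡ eq)

lookup-permute : ∀ (σ : Permutation′ n) w i → lookup (permute σ w) i ≡ lookup w (σ ⟨$⟩ʳ i)
lookup-permute σ w = Vecₚ.lookup∘tabulate _

permute-permute : ∀ (σ ρ : Permutation′ n) w →
  permute σ (permute ρ w) ≡ tabulate (λ i → lookup w (ρ ⟨$⟩ʳ (σ ⟨$⟩ʳ i)))
permute-permute σ ρ w = Vecₚ.tabulate-cong (λ i → lookup-permute ρ w (σ ⟨$⟩ʳ i))

permute-inverse : ∀ (σ ρ : Permutation′ n) → (∀ i → ρ ⟨$⟩ʳ (σ ⟨$⟩ʳ i) ≡ i) →
  ∀ w → permute σ (permute ρ w) ≡ w
permute-inverse σ ρ ρσ≡id w = trans (permute-permute σ ρ w) (tabulate-≡ (cong (lookup w) ∘ ρσ≡id))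

permute-conjugates : ∀ {π σ τ : Permutation′ n} → Conjugates π (σ ⟨$⟩ʳ_) (τ ⟨$⟩ʳ_) →
  ∀ w → permute π (permute τ w) ≡ permute σ (permute π w)
permute-conjugates {π = π} {σ} {τ} π-conj w = begin
  permute π (permute τ w)
    ≡⟨ permute-permute π τ w ⟩
  tabulate (λ i → lookup w (τ ⟨$⟩ʳ (π ⟨$⟩ʳ i)))
    ≡⟨ Vecₚ.tabulate-cong (cong (lookup w) ∘ sym ∘ commute π-conj) ⟩
  tabulate (λ i → lookup w (π ⟨$⟩ʳ (σ ⟨$⟩ʳ i)))
    ≡⟨ permute-permute σ π w ⟨
  permute σ (permute π w) ∎
  where open ≡-Reasoning

permute-linear : ∀ {C : Word n → Set} (π : Permutation′ n) → IsBinaryLinear C → IsBinaryLinear (C ∘ permute π)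
permute-linear {C = C} π (C-zero , C-xor) =
  subst C (sym permute-zero) C-zero ,
  λ v w Cv Cw → subst C (sym (permute-xor v w)) (C-xor _ _ Cv Cw)
  where
  permute-zero : permute π (replicate _ false) ≡ replicate _ false
  permute-zero = tabulate-≡ λ i →
    trans (Vecₚ.lookup-replicate (π ⟨$⟩ʳ i) false) (sym (Vecₚ.lookup-replicate i false))
  permute-xor : ∀ v w → permute π (zipWith _xor_ v w) ≡ zipWith _xor_ (permute π v) (permute π w)
  permute-xor v w = tabulate-≡ λ i → begin
    lookup (zipWith _xor_ v w) (π ⟨$⟩ʳ i)
      ≡⟨ Vecₚ.lookup-zipWith _xor_ (π ⟨$⟩ʳ i) v w ⟩
    lookup v (π ⟨$⟩ʳ i) xor lookup w (π ⟨$⟩ʳ i)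
      ≡⟨ cong₂ _xor_ (lookup-permute π v i) (lookup-permute π w i) ⟨
    lookup (permute π v) i xor lookup (permute π w) i
      ≡⟨ Vecₚ.lookup-zipWith _xor_ i (permute π v) (permute π w) ⟨
    lookup (zipWith _xor_ (permute π v) (permute π w)) i ∎
    where open ≡-Reasoning

permute-invariant⇔ : ∀ {C : Word n → Set} {π σ τ : Permutation′ n} → Conjugates π (σ ⟨$⟩ʳ_) (τ ⟨$⟩ʳ_) →
  (∀ w → C w → C (permute σ w)) ⇔ (∀ w → C (permute π w) → C (permute π (permute τ w)))
permute-invariant⇔ {C = C} {π} {σ} {τ} π-conj = mk⇔
  (λ σ-closed w Cπw → subst C (sym (permute-conjugates {π = π} {σ} {τ} π-conj w)) (σ-closed _ Cπw))
  (λ τ-closed x Cx →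
    let w = permute (↔-sym π) x
        πw≡x = permute-inverse π (↔-sym π) (λ _ → inverseˡ π) x
    in subst (C ∘ permute σ) πw≡x
         (subst C (permute-conjugates {π = π} {σ} {τ} π-conj w) (τ-closed w (subst C (sym πw≡x) Cx))))

involution-inAut : ∀ {C : Word n → Set} (σ : Permutation′ n) → (∀ i → σ ⟨$⟩ʳ (σ ⟨$⟩ʳ i) ≡ i) →
  (∀ w → C w → C (permute σ w)) → InAut C σ
involution-inAut {C = C} σ σ-involutive σ-closed w =
  mk⇔ (σ-closed w) (λ Cσw → subst C (permute-inverse σ σ σ-involutive w) (σ-closed _ Cσw))

ψ-+u : ∀ a b → ψ (a +u b) ≡ zipWith _xor_ (ψ a) (ψ b)
ψ-+u 𝟘 𝟘 = refl
ψ-+u 𝟘 𝟙 = refl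
ψ-+u 𝟘 𝕦 = refl
ψ-+u 𝟘 𝟙𝕦 = refl
ψ-+u 𝟙 𝟘 = refl
ψ-+u 𝟙 𝟙 = refl
ψ-+u 𝟙 𝕦 = refl
ψ-+u 𝟙 𝟙𝕦 = refl
ψ-+u 𝕦 𝟘 = refl
ψ-+u 𝕦 𝟙 = refl
ψ-+u 𝕦 𝕦 = refl
ψ-+u 𝕦 𝟙𝕦 = refl
ψ-+u 𝟙𝕦 𝟘 = refl
ψ-+u 𝟙𝕦 𝟙 = refl
ψ-+u 𝟙𝕦 𝕦 = refl
ψ-+u 𝟙𝕦 𝟙𝕦 = refl

ψ-𝟙𝕦*u : ∀ a b → lookup (ψ (𝟙𝕦 *u a)) b ≡ lookup (ψ a) (opposite b)
ψ-𝟙𝕦*u 𝟘 0F = refl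
ψ-𝟙𝕦*u 𝟘 1F = refl
ψ-𝟙𝕦*u 𝟙 0F = refl
ψ-𝟙𝕦*u 𝟙 1F = refl
ψ-𝟙𝕦*u 𝕦 0F = refl
ψ-𝟙𝕦*u 𝕦 1F = refl
ψ-𝟙𝕦*u 𝟙𝕦 0F = refl
ψ-𝟙𝕦*u 𝟙𝕦 1F = refl

ψ⁻¹ : Vec Bool 2 → Z2u
ψ⁻¹ (false ∷ false ∷ []) = 𝟘
ψ⁻¹ (false ∷ true ∷ []) = 𝟙
ψ⁻¹ (true ∷ true ∷ []) = 𝕦
ψ⁻¹ (true ∷ false ∷ []) = 𝟙𝕦

ψ-ψ⁻¹ : ∀ v → ψ (ψ⁻¹ v) ≡ v
ψ-ψ⁻¹ (false ∷ false ∷ []) = refl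
ψ-ψ⁻¹ (false ∷ true ∷ []) = refl
ψ-ψ⁻¹ (true ∷ true ∷ []) = refl
ψ-ψ⁻¹ (true ∷ false ∷ []) = refl

𝟙*u-identity : ∀ a → 𝟙 *u a ≡ a
𝟙*u-identity 𝟘 = refl
𝟙*u-identity 𝟙 = refl
𝟙*u-identity 𝕦 = refl
𝟙*u-identity 𝟙𝕦 = refl

𝕦*u≡+u𝟙𝕦*u : ∀ a → 𝕦 *u a ≡ a +u (𝟙𝕦 *u a)
𝕦*u≡+u𝟙𝕦*u 𝟘 = refl
𝕦*u≡+u𝟙𝕦*u 𝟙 = refl
𝕦*u≡+u𝟙𝕦*u 𝕦 = refl
𝕦*u≡+u𝟙𝕦*u 𝟙𝕦 = refl

map-zipWith-self : ∀ {C : Set} {f : A → C} {g : A → B → C} {h : A → B} →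
  (∀ a → f a ≡ g a (h a)) → (xs : Vec A n) → map f xs ≡ zipWith g xs (map h xs)
map-zipWith-self eq [] = refl
map-zipWith-self eq (x ∷ xs) = cong₂ _∷_ (eq x) (map-zipWith-self eq xs)

smulE-𝟘 : ∀ (c : Elem α β) → smulE 𝟘 c ≡ zeroE
smulE-𝟘 (x , x′) = cong₂ _,_ (Vecₚ.map-const x false) (Vecₚ.map-const x′ 𝟘)

smulE-𝟙 : ∀ (c : Elem α β) → smulE 𝟙 c ≡ c
smulE-𝟙 (x , x′) = cong₂ _,_ (Vecₚ.map-id x) (trans (Vecₚ.map-cong 𝟙*u-identity x′) (Vecₚ.map-id x′))

smulE-𝕦 : ∀ (c : Elem α β) → smulE 𝕦 c ≡ addE c (smulE 𝟙𝕦 c)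
smulE-𝕦 (x , x′) = cong₂ _,_
  (map-zipWith-self (sym ∘ Boolₚ.xor-same) x) (map-zipWith-self 𝕦*u≡+u𝟙𝕦*u x′)

isAdditive-from-𝟙𝕦 : {𝒞 : Elem α β → Set} → 𝒞 zeroE → (∀ c d → 𝒞 c → 𝒞 d → 𝒞 (addE c d)) →
  (∀ c → 𝒞 c → 𝒞 (smulE 𝟙𝕦 c)) → IsAdditive 𝒞
isAdditive-from-𝟙𝕦 {𝒞 = 𝒞} 𝒞-zero 𝒞-add 𝒞-𝟙𝕦 = 𝒞-zero , 𝒞-add , 𝒞-smul
  where
  𝒞-smul : ∀ λ′ c → 𝒞 c → 𝒞 (smulE λ′ c)
  𝒞-smul 𝟘 c _ = subst 𝒞 (sym (smulE-𝟘 c)) 𝒞-zero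
  𝒞-smul 𝟙 c c∈𝒞 = subst 𝒞 (sym (smulE-𝟙 c)) c∈𝒞
  𝒞-smul 𝕦 c c∈𝒞 = subst 𝒞 (sym (smulE-𝕦 c)) (𝒞-add _ _ c∈𝒞 (𝒞-𝟙𝕦 c c∈𝒞))
  𝒞-smul 𝟙𝕦 c c∈𝒞 = 𝒞-𝟙𝕦 c c∈𝒞

Coord : ℕ → ℕ → Set
Coord α β = Fin α ⊎ (Fin β × Fin 2)

module _ {α β : ℕ} where

  layout : Fin (α + 2 * β) ↔ Coord α β
  layout = ↔-trans Finₚ.+↔⊎ (↔-refl ⊎-↔ ↔-trans (↔-sym (cast-id (ℕₚ.*-comm β 2))) Finₚ.*↔×)

  τ : Permutation′ (α + 2 * β)
  τ = conjugate layout swapPairs-↔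

  bitAt : Elem α β → Coord α β → Bool
  bitAt (x , _) (inj₁ k) = lookup x k
  bitAt (_ , x′) (inj₂ (j , b)) = lookup (ψ (lookup x′ j)) b

  lookup-Ψ-from : ∀ (c : Elem α β) s → lookup (Ψ c) (from layout s) ≡ bitAt c s
  lookup-Ψ-from (x , x′) (inj₁ k) = Vecₚ.lookup-++ˡ x _ k
  lookup-Ψ-from (x , x′) (inj₂ (j , b)) = begin
    lookup (x ++ Vec.cast eq (concat (map ψ x′))) (α ↑ʳ Fin.cast eq (combine j b))
      ≡⟨ Vecₚ.lookup-++ʳ x _ _ ⟩
    lookup (Vec.cast eq (concat (map ψ x′))) (Fin.cast eq (combine j b))
      ≡⟨ Vecₚ.lookup-cast eq _ _ ⟩
    lookup (concat (map ψ x′)) (combine j b)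
      ≡⟨ Vecₚ.lookup-concat (map ψ x′) j b ⟩
    lookup (lookup (map ψ x′) j) b
      ≡⟨ cong (λ v → lookup v b) (Vecₚ.lookup-map j ψ x′) ⟩
    lookup (ψ (lookup x′ j)) b ∎
    where
    open ≡-Reasoning
    eq = ℕₚ.*-comm β 2

  lookup-Ψ : ∀ (c : Elem α β) i → lookup (Ψ c) i ≡ bitAt c (to layout i)
  lookup-Ψ c i = trans (cong (lookup (Ψ c)) (sym (strictlyInverseʳ layout i))) (lookup-Ψ-from c (to layout i))

  Ψ-≡ : ∀ {c : Elem α β} {w} → (∀ s → bitAt c s ≡ lookup w (from layout s)) → Ψ c ≡ w
  Ψ-≡ {c = c} {w} eq = lookup-ext λ i →
    trans (lookup-Ψ c i) (trans (eq (to layout i)) (cong (lookup w) (strictlyInverseʳ layout i)))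

  Ψ-zeroE : Ψ (zeroE {α} {β}) ≡ replicate _ false
  Ψ-zeroE = Ψ-≡ λ s → trans (bitAt-zeroE s) (sym (Vecₚ.lookup-replicate (from layout s) false))
    where
    bitAt-zeroE : ∀ s → bitAt zeroE s ≡ false
    bitAt-zeroE (inj₁ k) = Vecₚ.lookup-replicate k false
    bitAt-zeroE (inj₂ (j , b)) =
      trans (cong (λ a → lookup (ψ a) b) (Vecₚ.lookup-replicate j 𝟘)) (Vecₚ.lookup-replicate b false)

  Ψ-addE : ∀ (c d : Elem α β) → Ψ (addE c d) ≡ zipWith _xor_ (Ψ c) (Ψ d)
  Ψ-addE c d = Ψ-≡ λ s → trans (bitAt-addE c d s) (sym (trans
    (Vecₚ.lookup-zipWith _xor_ _ (Ψ c) (Ψ d)) (cong₂ _xor_ (lookup-Ψ-from c s) (lookup-Ψ-from d s))))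
    where
    bitAt-addE : ∀ c d s → bitAt (addE c d) s ≡ bitAt c s xor bitAt d s
    bitAt-addE (x , _) (y , _) (inj₁ k) = Vecₚ.lookup-zipWith _xor_ k x y
    bitAt-addE (_ , x′) (_ , y′) (inj₂ (j , b)) = begin
      lookup (ψ (lookup (zipWith _+u_ x′ y′) j)) b
        ≡⟨ cong (λ a → lookup (ψ a) b) (Vecₚ.lookup-zipWith _+u_ j x′ y′) ⟩
      lookup (ψ (lookup x′ j +u lookup y′ j)) b
        ≡⟨ cong (λ v → lookup v b) (ψ-+u (lookup x′ j) (lookup y′ j)) ⟩
      lookup (zipWith _xor_ (ψ (lookup x′ j)) (ψ (lookup y′ j))) b
        ≡⟨ Vecₚ.lookup-zipWith _xor_ b (ψ (lookup x′ j)) (ψ (lookup y′ j)) ⟩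
      lookup (ψ (lookup x′ j)) b xor lookup (ψ (lookup y′ j)) b ∎
      where open ≡-Reasoning

  Ψ-𝟙𝕦 : ∀ (c : Elem α β) → Ψ (smulE 𝟙𝕦 c) ≡ permute τ (Ψ c)
  Ψ-𝟙𝕦 c = Ψ-≡ λ s → trans (bitAt-𝟙𝕦 c s) (sym (begin
    lookup (permute τ (Ψ c)) (from layout s)
      ≡⟨ lookup-permute τ (Ψ c) _ ⟩
    lookup (Ψ c) (from layout (swapPairs (to layout (from layout s))))
      ≡⟨ cong (λ s′ → lookup (Ψ c) (from layout (swapPairs s′))) (strictlyInverseˡ layout s) ⟩
    lookup (Ψ c) (from layout (swapPairs s))
      ≡⟨ lookup-Ψ-from c (swapPairs s) ⟩
    bitAt c (swapPairs s) ∎))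
    where
    open ≡-Reasoning
    bitAt-𝟙𝕦 : ∀ c s → bitAt (smulE 𝟙𝕦 c) s ≡ bitAt c (swapPairs s)
    bitAt-𝟙𝕦 (x , _) (inj₁ k) = Vecₚ.lookup-map k _ x
    bitAt-𝟙𝕦 (_ , x′) (inj₂ (j , b)) =
      trans (cong (λ a → lookup (ψ a) b) (Vecₚ.lookup-map j _ x′)) (ψ-𝟙𝕦*u (lookup x′ j) b)

  Ψ-surjective : ∀ (w : Word (α + 2 * β)) → ∃ λ c → Ψ c ≡ w
  Ψ-surjective w = c , Ψ-≡ {c = c} {w} λ
    { (inj₁ k) → Vecₚ.lookup∘tabulate _ k
    ; (inj₂ (j , b)) → begin
        lookup (ψ (lookup (proj₂ c) j)) b  ≡⟨ cong (λ a → lookup (ψ a) b) (Vecₚ.lookup∘tabulate _ j) ⟩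
        lookup (ψ (ψ⁻¹ (pair j))) b        ≡⟨ cong (λ v → lookup v b) (ψ-ψ⁻¹ (pair j)) ⟩
        lookup (pair j) b                  ≡⟨ Vecₚ.lookup∘tabulate (λ b → w at inj₂ (j , b)) b ⟩
        w at inj₂ (j , b) ∎ }
    where
    open ≡-Reasoning
    _at_ : Word (α + 2 * β) → Coord α β → Bool
    v at s = lookup v (from layout s)
    pair : Fin β → Vec Bool 2
    pair j = tabulate (λ b → w at inj₂ (j , b))
    c : Elem α β
    c = tabulate (λ k → w at inj₁ k) , tabulate (ψ⁻¹ ∘ pair)

  conjugate-τ-conjugates : (π : Permutation′ (α + 2 * β)) →
    Conjugates (↔-trans π layout) (conjugate π τ ⟨$⟩ʳ_) swapPairs
  conjugate-τ-conjugates π = conjugates-trans (conjugate-conjugates π τ) (conjugate-conjugates layout swapPairs-↔)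

  conjugate-τ-hasOrder2 : 0 < β → (π : Permutation′ (α + 2 * β)) → HasOrder2 (conjugate π τ)
  conjugate-τ-hasOrder2 0<β π = conjugates-involutive ρ-conj swapPairs-involutive , nontrivial
    where
    ρ-conj = conjugate-τ-conjugates π
    nontrivial : ¬ (∀ i → conjugate π τ ⟨$⟩ʳ i ≡ i)
    nontrivial σ≗id with conjugates-id ρ-conj σ≗id (inj₂ (Fin.fromℕ< 0<β , 0F))
    ... | ()

  numFixed-conjugate-τ : (π : Permutation′ (α + 2 * β)) → numFixed (conjugate π τ) ≡ α
  numFixed-conjugate-τ π = ↔⇒≡ (↔-trans (filter-tabulate-↔ (λ i → conjugate π τ ⟨$⟩ʳ i Finₚ.≟ i) uip id)
    (↔-trans (Fix-↔ (conjugate-τ-conjugates π)) Fix-swapPairs-↔))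

  involution-conjugate-τ : (σ : Permutation′ (α + 2 * β)) → (∀ i → σ ⟨$⟩ʳ (σ ⟨$⟩ʳ i) ≡ i) →
    numFixed σ ≡ α → Σ (Permutation′ (α + 2 * β)) λ π → Conjugates π (σ ⟨$⟩ʳ_) (τ ⟨$⟩ʳ_)
  involution-conjugate-τ σ σ-involutive σ-fixed =
    ↔-trans involution-↔ (↔-trans relabel (↔-sym layout)) ,
    conjugates-trans involution-↔-conjugates (conjugates-trans relabel-conj layout⁻¹-conj)
    where
    open Involution {s = σ ⟨$⟩ʳ_} σ-involutive
    fix↔ : Fix (σ ⟨$⟩ʳ_) ↔ Fin α
    fix↔ = subst (λ k → Fix _ ↔ Fin k) σ-fixed (↔-sym (filter-tabulate-↔ (λ i → σ ⟨$⟩ʳ i Finₚ.≟ i) uip id))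
    pairs↔ : Pairs ↔ Fin β
    pairs↔ = Pairs-↔ fix↔ refl
    relabel : (Fix (σ ⟨$⟩ʳ_) ⊎ (Pairs × Fin 2)) ↔ Coord α β
    relabel = fix↔ ⊎-↔ (pairs↔ ×-↔ ↔-refl)
    relabel-conj : Conjugates relabel swapPairs swapPairs
    relabel-conj = relabel-conjugates fix↔ pairs↔
    layout⁻¹-conj : Conjugates (↔-sym layout) swapPairs (τ ⟨$⟩ʳ_)
    layout⁻¹-conj = conjugates-sym (conjugate-conjugates layout swapPairs-↔)

  Ψ-preimage⇔ : (D : Word (α + 2 * β) → Set) → ∀ w → D w ⇔ (∃ λ c → D (Ψ c) × Ψ c ≡ w)
  Ψ-preimage⇔ D w = mk⇔
    (λ Dw → let (c , Ψc≡w) = Ψ-surjective w in c , subst D (sym Ψc≡w) Dw , Ψc≡w)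
    (λ (c , Dc , Ψc≡w) → subst D Ψc≡w Dc)

  forward : 0 < β → (C : Word (α + 2 * β) → Set) → IsZ2Z2uLinear α β C →
    Σ (Permutation′ (α + 2 * β)) (λ σ → InAut C σ × HasOrder2 σ × numFixed σ ≡ α)
  forward 0<β C (𝒞 , (_ , _ , 𝒞-smul) , π , C∘π⇔Ψ𝒞) =
    σ , involution-inAut σ (proj₁ σ-order2) σ-closed , σ-order2 , numFixed-conjugate-τ π
    where
    σ = conjugate π τ
    σ-order2 = conjugate-τ-hasOrder2 0<β π
    τ-closed : ∀ w → C (permute π w) → C (permute π (permute τ w))
    τ-closed w Cπw with Equivalence.to (C∘π⇔Ψ𝒞 w) Cπw
    ... | c , c∈𝒞 , refl = Equivalence.from (C∘π⇔Ψ𝒞 _) (smulE 𝟙𝕦 c , 𝒞-smul 𝟙𝕦 c c∈𝒞 , Ψ-𝟙𝕦 c)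
    σ-closed : ∀ w → C w → C (permute σ w)
    σ-closed = Equivalence.from (permute-invariant⇔ {C = C} {π} {σ} {τ} (conjugate-conjugates π τ)) τ-closed

  backward : (C : Word (α + 2 * β) → Set) → IsBinaryLinear C →
    Σ (Permutation′ (α + 2 * β)) (λ σ → InAut C σ × HasOrder2 σ × numFixed σ ≡ α) → IsZ2Z2uLinear α β C
  backward C C-linear (σ , σ-aut , (σ-involutive , _) , σ-fixed) = D ∘ Ψ , 𝒞-additive , π , Ψ-preimage⇔ D
    where
    π = proj₁ (involution-conjugate-τ σ σ-involutive σ-fixed)
    π-conj = proj₂ (involution-conjugate-τ σ σ-involutive σ-fixed)
    D : Word (α + 2 * β) → Set
    D = C ∘ permute π
    D-linear : IsBinaryLinear D
    D-linear = permute-linear π C-linear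
    τ-closed : ∀ w → D w → D (permute τ w)
    τ-closed = Equivalence.to (permute-invariant⇔ {C = C} {π} {σ} {τ} π-conj) (λ w → Equivalence.to (σ-aut w))
    𝒞-additive : IsAdditive (D ∘ Ψ)
    𝒞-additive = isAdditive-from-𝟙𝕦
      (subst D (sym Ψ-zeroE) (proj₁ D-linear))
      (λ c d c∈𝒞 d∈𝒞 → subst D (sym (Ψ-addE c d)) (proj₂ D-linear (Ψ c) (Ψ d) c∈𝒞 d∈𝒞))
      (λ c c∈𝒞 → subst D (sym (Ψ-𝟙𝕦 c)) (τ-closed (Ψ c) c∈𝒞))

proposition3 : (α β : ℕ) → 0 < β → (C : Word (α + 2 * β) → Set) → IsBinaryLinear C →
    IsZ2Z2uLinear α β C ⇔
      Σ (Permutation′ (α + 2 * β)) (λ σ → InAut C σ × HasOrder2 σ × numFixed σ ≡ α)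
proposition3 α β 0<β C C-linear = mk⇔ (forward 0<β C) (backward C C-linear)
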